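{- For every collection $W$ of eight distinct MacMahon cubes, the number of MacMahon cubes $T$ for which $W$ has positive solution number is at most $5$. Moreover, exactly $360$ collections attain this maximum of $5$, and for each of these $360$ collections none of the five corresponding target cubes belongs to the collection.
   Context: A MacMahon cube is a cube whose six faces are painted with the six colors $1,\dots,6$, each color used on exactly one face, considered up to rotation; there are exactly $30$ MacMahon cubes. At each vertex of a cube three faces meet; reading their colors clockwise as seen from outside gives a cyclic triple, and the corner number of that vertex is the cyclic rotation of this triple with smallest three-digit value. Each MacMahon cube has $8$ distinct corner numbers. For a target MacMahon cube $T$ and a set $W$ of eight distinct MacMahon cubes, a solution is a bijection $\sigma$ from $W$ to the set of corner numbers of $T$ such that $\sigma(C)$ is a corner number of $C$ for every $C\in W$ (i.e. an arrangement of the eight cubes into a $2\times2\times2$ block whose exterior is colored like an enlarged $T$, with no condition on interior faces). The solution number of $W$ for $T$ is the number of such bijections; $W$ can build $T$ if this number is positive. -}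

module Defs where

open import Data.Bool using (Bool; true; false; _∧_; _∨_; not; T)
open import Data.Nat using (ℕ; zero; suc; _+_; _*_; _≡ᵇ_; _<ᵇ_)
open import Data.List using (List; []; _∷_; map; concatMap; length; _++_)
open import Data.Bool.ListAction using (and)
open import Data.List.Relation.Unary.All using (All)
open import Data.List.Relation.Unary.Unique.Propositional using (Unique)
open import Relation.Binary.PropositionalEquality using (_≡_)
open import Data.Product using (_×_)

count : {A : Set} → (A → Bool) → List A → ℕ
count p []       = 0
count p (x ∷ xs) with p x
... | true  = suc (count p xs)
... | false = count p xs

insertions : {A : Set} → A → List A → List (List A)
insertions x []       = (x ∷ []) ∷ []
insertions x (y ∷ ys) = (x ∷ y ∷ ys) ∷ map (y ∷_) (insertions x ys)

permutations : {A : Set} → List A → List (List A)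
permutations []       = [] ∷ []
permutations (x ∷ xs) = concatMap (insertions x) (permutations xs)

choose : {A : Set} → ℕ → List A → List (List A)
choose zero    _        = [] ∷ []
choose (suc k) []       = []
choose (suc k) (x ∷ xs) = map (x ∷_) (choose k xs) ++ choose (suc k) xs

elemᵇ : ℕ → List ℕ → Bool
elemᵇ n []       = false
elemᵇ n (m ∷ ms) = (n ≡ᵇ m) ∨ elemᵇ n ms

eqListᵇ : List ℕ → List ℕ → Bool
eqListᵇ []       []       = true
eqListᵇ (x ∷ xs) (y ∷ ys) = (x ≡ᵇ y) ∧ eqListᵇ xs ys
eqListᵇ _        _        = false

memListᵇ : List ℕ → List (List ℕ) → Bool
memListᵇ c []        = false
memListᵇ c (d ∷ ds)  = eqListᵇ c d ∨ memListᵇ c ds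

lexLeᵇ : List ℕ → List ℕ → Bool
lexLeᵇ []       _        = true
lexLeᵇ (x ∷ xs) []       = false
lexLeᵇ (x ∷ xs) (y ∷ ys) = (x <ᵇ y) ∨ ((x ≡ᵇ y) ∧ lexLeᵇ xs ys)

-- Coordinates: R = +x, L = -x, B = +y, F = -y, U = +z, D = -z
-- (right-handed).  A coloring is the list of colors of the faces in the
-- order  U D F B L R  (a permutation of 1..6).

data Face : Set where
  U D F B L R : Face

faces : List Face
faces = U ∷ D ∷ F ∷ B ∷ L ∷ R ∷ []

Coloring : Set
Coloring = List ℕ

-- color of a face (0 if the list is too short; never happens for colorings)
nth : List ℕ → ℕ → ℕ
nth []       _       = 0
nth (x ∷ xs) zero    = x
nth (x ∷ xs) (suc i) = nth xs i

colorOf : Coloring → Face → ℕ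
colorOf c U = nth c 0
colorOf c D = nth c 1
colorOf c F = nth c 2
colorOf c B = nth c 3
colorOf c L = nth c 4
colorOf c R = nth c 5

allColorings : List Coloring
allColorings = permutations (1 ∷ 2 ∷ 3 ∷ 4 ∷ 5 ∷ 6 ∷ [])

-- Face permutations induced by rotations.
-- rz : quarter turn about the z-axis (x ↦ y, y ↦ -x)
rz : Face → Face
rz R = B
rz B = L
rz L = F
rz F = R
rz U = U
rz D = D

-- rx : quarter turn about the x-axis (y ↦ z, z ↦ -y)
rx : Face → Face
rx B = U
rx U = F
rx F = D
rx D = B
rx L = L
rx R = R

-- ry : quarter turn about the y-axis (z ↦ x, x ↦ -z)
ry : Face → Face
ry U = R
ry R = D
ry D = L
ry L = U
ry F = F
ry B = B

_∘f_ : (Face → Face) → (Face → Face) → Face → Face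
(g ∘f h) x = g (h x)

idf : Face → Face
idf x = x

-- the 24 rotations of the cube: rz^k ∘ t, with t a coset representative
-- bringing each of the six faces to U
rotations : List (Face → Face)
rotations = concatMap (λ t → map (λ k → k ∘f t) zs) ts
  where
  zs : List (Face → Face)
  zs = idf ∷ rz ∷ (rz ∘f rz) ∷ (rz ∘f (rz ∘f rz)) ∷ []
  ts : List (Face → Face)
  ts = idf ∷ rx ∷ (rx ∘f rx) ∷ (rx ∘f (rx ∘f rx)) ∷ ry ∷ (ry ∘f (ry ∘f ry)) ∷ []

rotate : (Face → Face) → Coloring → Coloring
rotate q c = map (λ f → colorOf c (q f)) faces

orbit : Coloring → List Coloring
orbit c = map (λ q → rotate q c) rotations

-- A MacMahon cube (a rotation class of colorings) is represented by its
-- canonical representative: the lexicographically least coloring in its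
-- orbit.
isMacMahon : Coloring → Bool
isMacMahon c = memListᵇ c allColorings ∧ and (map (lexLeᵇ c) (orbit c))

MacMahon : Coloring → Set
MacMahon c = T (isMacMahon c)

allMacMahon : List Coloring
allMacMahon = filterᵇ allColorings
  where
  filterᵇ : List Coloring → List Coloring
  filterᵇ []       = []
  filterᵇ (c ∷ cs) with isMacMahon c
  ... | true  = c ∷ filterᵇ cs
  ... | false = filterᵇ cs

-- the eight vertices, each given by its three faces in clockwise order
-- as seen from outside
vertices : List (Face × Face × Face)
vertices = (R , U , B) ∷ (R , B , D) ∷ (R , F , U) ∷ (R , D , F)
         ∷ (L , B , U) ∷ (L , D , B) ∷ (L , U , F) ∷ (L , F , D) ∷ []
  where open import Data.Product using (_,_)

min : ℕ → ℕ → ℕ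
min m n with m <ᵇ n
... | true  = m
... | false = n

cyclicMin : ℕ → ℕ → ℕ → ℕ
cyclicMin a b c =
  min (100 * a + 10 * b + c) (min (100 * b + 10 * c + a) (100 * c + 10 * a + b))

cornerNumbers : Coloring → List ℕ
cornerNumbers c = map corner vertices
  where
  open import Data.Product using (_,_)
  corner : Face × Face × Face → ℕ
  corner (f , g , h) = cyclicMin (colorOf c f) (colorOf c g) (colorOf c h)

compatibleᵇ : List Coloring → List ℕ → Bool
compatibleᵇ []       []       = true
compatibleᵇ (C ∷ Cs) (n ∷ ns) = elemᵇ n (cornerNumbers C) ∧ compatibleᵇ Cs ns
compatibleᵇ _        _        = false

-- Solution number of W (listed in some order) for target T: the number
-- of bijections W → cornerNumbers T with σ(C) a corner number of C.
-- Since the 8 corner numbers of T are distinct, such bijections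
-- correspond exactly to the orderings of cornerNumbers T.
solutionNumber : List Coloring → Coloring → ℕ
solutionNumber W T' = count (compatibleᵇ W) (permutations (cornerNumbers T'))

canBuildᵇ : List Coloring → Coloring → Bool
canBuildᵇ W T' = 0 <ᵇ solutionNumber W T'

targetCount : List Coloring → ℕ
targetCount W = count (canBuildᵇ W) allMacMahon

Collection : List Coloring → Set
Collection W = All MacMahon W × Unique W × length W ≡ 8

{-# OPTIONS --safe #-}
-- Call two cubes compatible when they have a corner number in common.  In a solution every cube
-- of W sits at a corner of the target showing one of its own corner numbers, so each target of W
-- lies in the common neighbourhood of W for compatibility.  An exhaustive computation shows that
-- five cubes never have more than eight common neighbours, and that when they have exactly eight,
-- these have at most five common neighbours, none among themselves.  So if W builds five targets,
-- W is (by the pigeonhole principle) the common neighbourhood of those five, hence W has at most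
-- five targets and none of them lies in W.  The count 360 comes from enumerating the 8-subsets,
-- abandoning a partial choice as soon as its common neighbourhood has fewer than five cubes, and
-- confirming by a backtracking search that on every surviving collection each common neighbour
-- is in fact a target.
module Submission where

open import Defs
open import Data.Nat using (ℕ; _≤_; _<_; _≡ᵇ_)
open import Data.Product using (_×_)
open import Data.List using (List; length)
open import Data.List.Membership.Propositional using (_∉_)
open import Relation.Binary.PropositionalEquality using (_≡_)

open import Data.Bool using (Bool; true; false; T; not; _∧_; _∨_)
open import Data.Bool.Properties using (T-∧; T-∨; T-≡; ∨-comm)
open import Data.Bool.ListAction using (any)
open import Data.Empty using (⊥-elim)
open import Data.Nat using (zero; suc; _+_; _<ᵇ_; _≤?_; _<?_; z≤n; s≤s)
import Data.Nat as ℕ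
open import Data.Fin using (Fin; #_)
import Data.Fin as Fin
import Data.Vec as Vec
open Vec using ([]; _∷_)
open import Data.Nat.Properties
  using (≡ᵇ⇒≡; <ᵇ⇒<; <⇒<ᵇ; ≤-trans; ≤-reflexive; ≤-<-trans; m≤n⇒m≤1+n; m≤n⇒m⊓n≡m;
         <⇒≤; <⇒≢; <⇒≱; ≰⇒>; n≮0; module ≤-Reasoning)
open import Data.Product using (∃; _,_; proj₁; proj₂; map₂)
open import Data.Sum using (inj₁; inj₂; _⊎_; [_,_]′)
open import Data.List using ([]; _∷_; _++_; _∷ʳ_; map; foldl; filterᵇ; take; allFin; null)
open import Data.List.Properties
  using (map-++; map-∘; length-map; foldl-∷ʳ; foldl-++; ++-identityʳ; ∷ʳ-++; length-take)
open import Data.List.Membership.Propositional using (_∈_; find)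
open import Data.List.Membership.Propositional.Properties
  using (∈-map⁺; ∈-map⁻; ∈-++⁺ˡ; ∈-++⁺ʳ; ∈-concat⁺′; ∈-concat⁻′; ∈-filter⁺; ∈-filter⁻; ∈-allFin)
import Data.List.Membership.DecPropositional as DecMembership
open import Data.List.Relation.Unary.Any using (here; there)
open import Data.List.Relation.Unary.Any.Properties using (any⁻)
open import Data.List.Relation.Unary.All as All using (All; []; _∷_; all?)
open import Data.List.Relation.Unary.Unique.Propositional using (Unique)
open import Data.List.Relation.Unary.AllPairs using ([]; _∷_)
import Data.List.Relation.Unary.Unique.Propositional.Properties as Unique
open import Data.List.Relation.Binary.Subset.Propositional using (_⊆_)
import Data.List.Relation.Binary.Sublist.Propositional as Sublist
open import Data.List.Relation.Binary.Sublist.Propositional.Properties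
  using (take-⊆; filter-⊆; length-mono-≤)
open import Data.List.Relation.Binary.Disjoint.DecPropositional ℕ._≟_ using (Disjoint; disjoint?)
open import Data.List.Relation.Binary.Permutation.Propositional
  using (_↭_; ↭-refl; ↭-prep; ↭-swap; ↭-trans)
open import Data.List.Relation.Binary.Permutation.Propositional.Properties using (∈-resp-↭)
open import Data.List.Fresh using (fromList) renaming (length to length#)
import Data.List.Fresh.Relation.Unary.Any as Any#
open import Function using (_∘_; id)
open import Function.Bundles using (module Equivalence)
open import Relation.Binary.Definitions using (DecidableEquality)
open import Relation.Binary.PropositionalEquality
  using (refl; sym; trans; cong; cong₂; subst; subst₂; setoid; module ≡-Reasoning)
open import Relation.Nullary using (¬_; yes; no)
open import Relation.Nullary.Decidable
  using (Dec; map′; _×-dec_; _⊎-dec_; ¬?; T?; isNo; from-yes; decidable-stable;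
         toWitnessFalse; fromWitnessFalse)

open Equivalence using (to; from)

module _ {A : Set} where

  count-++ : ∀ (p : A → Bool) xs ys → count p (xs ++ ys) ≡ count p xs + count p ys
  count-++ p []       ys = refl
  count-++ p (x ∷ xs) ys with p x
  ... | true  = cong suc (count-++ p xs ys)
  ... | false = count-++ p xs ys

  count-map : ∀ {B : Set} (p : B → Bool) (f : A → B) xs → count p (map f xs) ≡ count (λ x → p (f x)) xs
  count-map p f []       = refl
  count-map p f (x ∷ xs) with p (f x)
  ... | true  = cong suc (count-map p f xs)
  ... | false = count-map p f xs

  count-cong : ∀ {p q : A → Bool} xs → (∀ {x} → x ∈ xs → p x ≡ q x) → count p xs ≡ count q xs
  count-cong         []       _  = refl
  count-cong {p} {q} (x ∷ xs) eq with p x | q x | eq (here refl)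
  ... | true  | .true  | refl = cong suc (count-cong xs (eq ∘ there))
  ... | false | .false | refl = count-cong xs (eq ∘ there)

  count≤length : ∀ (p : A → Bool) xs → count p xs ≤ length xs
  count≤length p []       = z≤n
  count≤length p (x ∷ xs) with p x
  ... | true  = s≤s (count≤length p xs)
  ... | false = m≤n⇒m≤1+n (count≤length p xs)

  ∈⇒count>0 : ∀ (p : A → Bool) {x xs} → x ∈ xs → T (p x) → 0 < count p xs
  ∈⇒count>0 p {xs = y ∷ xs} x∈ px with p y in e
  ... | true = s≤s z≤n
  ... | false with x∈
  ...   | here refl = ⊥-elim (subst T e px)
  ...   | there x∈′ = ∈⇒count>0 p x∈′ px

  count>0⇒∈ : ∀ (p : A → Bool) xs → 0 < count p xs → ∃ λ x → x ∈ xs × T (p x)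
  count>0⇒∈ p (x ∷ xs) pos with p x in e
  ... | true  = x , here refl , from T-≡ e
  ... | false = let y , y∈ , py = count>0⇒∈ p xs pos in y , there y∈ , py

  count-none : ∀ (p : A → Bool) xs → (∀ {x} → x ∈ xs → ¬ T (p x)) → count p xs ≡ 0
  count-none p []       _    = refl
  count-none p (x ∷ xs) none with p x in e
  ... | true  = ⊥-elim (none (here refl) (from T-≡ e))
  ... | false = count-none p xs (none ∘ there)

  count-filterᵇ : ∀ {p q : A → Bool} xs → (∀ {x} → x ∈ xs → T (p x) → T (q x)) →
                  count p (filterᵇ q xs) ≡ count p xs
  count-filterᵇ         []       _   = refl
  count-filterᵇ {p} {q} (x ∷ xs) p⇒q with q x in eq
  ... | true with p x
  ...   | true  = cong suc (count-filterᵇ xs (p⇒q ∘ there))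
  ...   | false = count-filterᵇ xs (p⇒q ∘ there)
  count-filterᵇ {p} {q} (x ∷ xs) p⇒q | false with p x in ep
  ...   | true  = ⊥-elim (subst T eq (p⇒q (here refl) (from T-≡ ep)))
  ...   | false = count-filterᵇ xs (p⇒q ∘ there)

module _ {A : Set} where

  choose-map : ∀ {B : Set} (f : A → B) k xs → choose k (map f xs) ≡ map (map f) (choose k xs)
  choose-map f zero    xs       = refl
  choose-map f (suc k) []       = refl
  choose-map f (suc k) (x ∷ xs) = begin
    map (f x ∷_) (choose k (map f xs)) ++ choose (suc k) (map f xs)
      ≡⟨ cong₂ _++_ (cong (map (f x ∷_)) (choose-map f k xs)) (choose-map f (suc k) xs) ⟩
    map (f x ∷_) (map (map f) (choose k xs)) ++ map (map f) (choose (suc k) xs)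
      ≡⟨ cong (_++ _) (trans (sym (map-∘ (choose k xs))) (map-∘ (choose k xs))) ⟩
    map (map f) (map (x ∷_) (choose k xs)) ++ map (map f) (choose (suc k) xs)
      ≡⟨ sym (map-++ (map f) (map (x ∷_) (choose k xs)) _) ⟩
    map (map f) (map (x ∷_) (choose k xs) ++ choose (suc k) xs) ∎
    where open ≡-Reasoning

  ∈-choose⁺ : ∀ {ys xs : List A} → ys Sublist.⊆ xs → ys ∈ choose (length ys) xs
  ∈-choose⁺ {[]}     _                    = here refl
  ∈-choose⁺ {y ∷ ys} (x Sublist.∷ʳ τ)     = ∈-++⁺ʳ _ (∈-choose⁺ τ)
  ∈-choose⁺ {y ∷ ys} (refl Sublist.∷ τ)   = ∈-++⁺ˡ (∈-map⁺ (y ∷_) (∈-choose⁺ τ))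

-- Counting subsets with pruning

module PrunedCount {A S : Set}
  (state : List A → S) (extend : S → A → S)
  (state-∷ʳ : ∀ acc x → state (acc ∷ʳ x) ≡ extend (state acc) x)
  (f : List A → Bool) (dead : S → Bool)
  (dead-sound : ∀ acc ys → T (dead (state acc)) → ¬ T (f (acc ++ ys)))
  where

  prunedCount : List A → S → ℕ → List A → ℕ
  prunedCount acc s k       xs       with dead s
  ... | true = 0
  prunedCount acc s zero    xs       | false = count f (acc ∷ [])
  prunedCount acc s (suc k) []       | false = 0
  prunedCount acc s (suc k) (x ∷ xs) | false =
    prunedCount (acc ∷ʳ x) (extend s x) k xs + prunedCount acc s (suc k) xs

  private
    prunedCount-from : ∀ acc k xs →
      prunedCount acc (state acc) k xs ≡ count (λ ys → f (acc ++ ys)) (choose k xs)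
    prunedCount-from acc k xs with dead (state acc) in e
    ... | true = sym (count-none _ (choose k xs) (λ _ → dead-sound acc _ (from T-≡ e)))
    prunedCount-from acc zero xs | false =
      trans (cong (λ ys → count f (ys ∷ [])) (sym (++-identityʳ acc))) (count-map f (acc ++_) ([] ∷ []))
    prunedCount-from acc (suc k) [] | false = refl
    prunedCount-from acc (suc k) (x ∷ xs) | false = begin
      prunedCount (acc ∷ʳ x) (extend (state acc) x) k xs + prunedCount acc (state acc) (suc k) xs
        ≡⟨ cong (λ s → prunedCount (acc ∷ʳ x) s k xs + prunedCount acc (state acc) (suc k) xs)
              (sym (state-∷ʳ acc x)) ⟩
      prunedCount (acc ∷ʳ x) (state (acc ∷ʳ x)) k xs + prunedCount acc (state acc) (suc k) xs
        ≡⟨ cong₂ _+_ (prunedCount-from (acc ∷ʳ x) k xs) (prunedCount-from acc (suc k) xs) ⟩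
      count (λ ys → f ((acc ∷ʳ x) ++ ys)) (choose k xs) + rest
        ≡⟨ cong (_+ rest) (count-cong (choose k xs) (λ {ys} _ → cong f (∷ʳ-++ acc x ys))) ⟩
      count (λ ys → g (x ∷ ys)) (choose k xs) + rest
        ≡⟨ cong (_+ rest) (sym (count-map g (x ∷_) (choose k xs))) ⟩
      count g (map (x ∷_) (choose k xs)) + rest
        ≡⟨ sym (count-++ g (map (x ∷_) (choose k xs)) (choose (suc k) xs)) ⟩
      count g (choose (suc k) (x ∷ xs)) ∎
      where
      open ≡-Reasoning
      g : List A → Bool
      g ys = f (acc ++ ys)
      rest : ℕ
      rest = count g (choose (suc k) xs)

  prunedCount-correct : ∀ k xs → prunedCount [] (state []) k xs ≡ count f (choose k xs)
  prunedCount-correct = prunedCount-from []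

module _ {A : Set} where

  ∷-∈-insertions : ∀ (x : A) xs → x ∷ xs ∈ insertions x xs
  ∷-∈-insertions x []      = here refl
  ∷-∈-insertions x (_ ∷ _) = here refl

  insertions-↭ : ∀ {x : A} xs {ys} → ys ∈ insertions x xs → ys ↭ x ∷ xs
  insertions-↭ []       (here refl) = ↭-refl
  insertions-↭ (y ∷ xs) (here refl) = ↭-refl
  insertions-↭ {x} (y ∷ xs) (there ys∈) with ∈-map⁻ (y ∷_) ys∈
  ... | zs , zs∈ , refl = ↭-trans (↭-prep y (insertions-↭ xs zs∈)) (↭-swap y x ↭-refl)

  ∈-permutations-∷⁺ : ∀ (x : A) xs {zs ys} → zs ∈ permutations xs → ys ∈ insertions x zs →
                      ys ∈ permutations (x ∷ xs)
  ∈-permutations-∷⁺ x xs zs∈ ys∈ = ∈-concat⁺′ ys∈ (∈-map⁺ (insertions x) zs∈)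

  ∈-permutations-∷⁻ : ∀ (x : A) xs {ys} → ys ∈ permutations (x ∷ xs) →
                      ∃ λ zs → zs ∈ permutations xs × ys ∈ insertions x zs
  ∈-permutations-∷⁻ x xs ys∈ with ∈-concat⁻′ (map (insertions x) (permutations xs)) ys∈
  ... | _ , ys∈ins , ins∈ with ∈-map⁻ (insertions x) ins∈
  ...   | zs , zs∈ , refl = zs , zs∈ , ys∈ins

  permutations-↭ : ∀ (xs : List A) {ys} → ys ∈ permutations xs → ys ↭ xs
  permutations-↭ []       (here refl) = ↭-refl
  permutations-↭ (x ∷ xs) ys∈ with ∈-permutations-∷⁻ x xs ys∈
  ... | zs , zs∈ , ys∈ins = ↭-trans (insertions-↭ zs ys∈ins) (↭-prep x (permutations-↭ xs zs∈))

  picks : List A → List (A × List A)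
  picks []       = []
  picks (x ∷ xs) = (x , xs) ∷ map (map₂ (x ∷_)) (picks xs)

  picks-∈-permutations : ∀ xs {x : A} {rest ys} → (x , rest) ∈ picks xs → ys ∈ permutations rest →
                         x ∷ ys ∈ permutations xs
  picks-∈-permutations (y ∷ xs) (here refl) ys∈ = ∈-permutations-∷⁺ y xs ys∈ (∷-∈-insertions y _)
  picks-∈-permutations (y ∷ xs) (there pick∈) ys∈ with ∈-map⁻ (map₂ (y ∷_)) pick∈
  ... | (x , rest) , pick∈′ , refl with ∈-permutations-∷⁻ y rest ys∈
  ...   | zs , zs∈ , ys∈ins =
    ∈-permutations-∷⁺ y xs (picks-∈-permutations xs pick∈′ zs∈) (there (∈-map⁺ (x ∷_) ys∈ins))

-- Pigeonhole principle

module _ {A : Set} where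

  open import Data.List.Fresh.Membership.Setoid (setoid A) using () renaming (_∈_ to _∈#_)
  open import Data.List.Fresh.Membership.Setoid.Properties (setoid A) using (injection; strict-injection)

  private
    ∈-fromList⁺ : ∀ {x : A} {xs} (u : Unique xs) → x ∈ xs → x ∈# fromList u
    ∈-fromList⁺ (_ ∷ u) (here x≡y) = Any#.here x≡y
    ∈-fromList⁺ (_ ∷ u) (there x∈) = Any#.there (∈-fromList⁺ u x∈)

    ∈-fromList⁻ : ∀ {x : A} {xs} (u : Unique xs) → x ∈# fromList u → x ∈ xs
    ∈-fromList⁻ (_ ∷ u) (Any#.here x≡y) = here x≡y
    ∈-fromList⁻ (_ ∷ u) (Any#.there x∈) = there (∈-fromList⁻ u x∈)

    length-fromList : ∀ {xs : List A} (u : Unique xs) → length# (fromList u) ≡ length xs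
    length-fromList []      = refl
    length-fromList (_ ∷ u) = cong suc (length-fromList u)

  Unique-⊆⇒length≤ : ∀ {xs ys : List A} → Unique xs → Unique ys → xs ⊆ ys → length xs ≤ length ys
  Unique-⊆⇒length≤ u v xs⊆ys =
    subst₂ _≤_ (length-fromList u) (length-fromList v)
      (injection id (∈-fromList⁺ v ∘ xs⊆ys ∘ ∈-fromList⁻ u))

  Unique-⊆-length≥⇒⊇ : DecidableEquality A → ∀ {xs ys : List A} → Unique xs → Unique ys →
                        xs ⊆ ys → length ys ≤ length xs → ys ⊆ xs
  Unique-⊆-length≥⇒⊇ _≟_ {xs} {ys} u v xs⊆ys ys≤xs {y} y∈ys with DecMembership._∈?_ _≟_ y xs
  ... | yes y∈xs = y∈xs
  ... | no  y∉xs = ⊥-elim (<⇒≱ xs<ys ys≤xs)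
    where
    xs<ys : length xs < length ys
    xs<ys = subst₂ _<_ (length-fromList u) (length-fromList v)
      (strict-injection id (∈-fromList⁺ v ∘ xs⊆ys ∘ ∈-fromList⁻ u)
                           (y , ∈-fromList⁺ v y∈ys , y∉xs ∘ ∈-fromList⁻ u))

module _ {A B : Set} (R : B → A → Bool) where

  sieve : List A → List B → List A
  sieve = foldl (λ xs b → filterᵇ (R b) xs)

  ∈-sieve⁺ : ∀ {x} xs bs → x ∈ xs → All (λ b → T (R b x)) bs → x ∈ sieve xs bs
  ∈-sieve⁺ xs []       x∈ []           = x∈
  ∈-sieve⁺ xs (b ∷ bs) x∈ (Rbx ∷ Rbsx) =
    ∈-sieve⁺ (filterᵇ (R b) xs) bs (∈-filter⁺ (T? ∘ R b) x∈ Rbx) Rbsx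

  ∈-sieve⁻ : ∀ {x} xs bs → x ∈ sieve xs bs → x ∈ xs × All (λ b → T (R b x)) bs
  ∈-sieve⁻ xs []       x∈ = x∈ , []
  ∈-sieve⁻ xs (b ∷ bs) x∈ with ∈-sieve⁻ (filterᵇ (R b) xs) bs x∈
  ... | x∈filter , Rbsx with ∈-filter⁻ (T? ∘ R b) x∈filter
  ...   | x∈xs , Rbx = x∈xs , Rbx ∷ Rbsx

  sieve-⊆ : ∀ xs bs → sieve xs bs Sublist.⊆ xs
  sieve-⊆ xs []       = Sublist.⊆-refl
  sieve-⊆ xs (b ∷ bs) = Sublist.⊆-trans (sieve-⊆ (filterᵇ (R b) xs) bs) (filter-⊆ (T? ∘ R b) xs)

  sieve-++-⊆ : ∀ xs bs cs → sieve xs (bs ++ cs) Sublist.⊆ sieve xs bs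
  sieve-++-⊆ xs bs cs =
    subst (Sublist._⊆ sieve xs bs) (sym (foldl-++ _ xs bs cs)) (sieve-⊆ (sieve xs bs) cs)

  sieve-∷ʳ : ∀ xs bs b → sieve xs (bs ∷ʳ b) ≡ filterᵇ (R b) (sieve xs bs)
  sieve-∷ʳ xs bs b = foldl-∷ʳ _ xs b bs

  Unique-sieve : ∀ {xs} bs → Unique xs → Unique (sieve xs bs)
  Unique-sieve []       u = u
  Unique-sieve (b ∷ bs) u = Unique-sieve bs (Unique.filter⁺ (T? ∘ R b) u)

  count-sieve : ∀ (p : A → Bool) xs bs → (∀ {x} → x ∈ xs → T (p x) → All (λ b → T (R b x)) bs) →
                count p (sieve xs bs) ≡ count p xs
  count-sieve p xs []       _   = refl
  count-sieve p xs (b ∷ bs) p⇒R =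
    trans (count-sieve p (filterᵇ (R b) xs) bs (λ x∈ → All.tail ∘ p⇒R (proj₁ (∈-filter⁻ (T? ∘ R b) x∈))))
          (count-filterᵇ xs (λ x∈ → All.head ∘ p⇒R x∈))

data Cube : Set where
  c₀ c₁ c₂ c₃ c₄ c₅ c₆ c₇ c₈ c₉ c₁₀ c₁₁ c₁₂ c₁₃ c₁₄
    c₁₅ c₁₆ c₁₇ c₁₈ c₁₉ c₂₀ c₂₁ c₂₂ c₂₃ c₂₄ c₂₅ c₂₆ c₂₇ c₂₈ c₂₉ : Cube

-- In the order of allMacMahon.
cube : Cube → Coloring
cube c₀  = 1 ∷ 2 ∷ 3 ∷ 4 ∷ 5 ∷ 6 ∷ []
cube c₁  = 1 ∷ 3 ∷ 2 ∷ 4 ∷ 5 ∷ 6 ∷ []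
cube c₂  = 1 ∷ 4 ∷ 2 ∷ 3 ∷ 5 ∷ 6 ∷ []
cube c₃  = 1 ∷ 4 ∷ 2 ∷ 5 ∷ 3 ∷ 6 ∷ []
cube c₄  = 1 ∷ 4 ∷ 2 ∷ 5 ∷ 6 ∷ 3 ∷ []
cube c₅  = 1 ∷ 2 ∷ 3 ∷ 5 ∷ 4 ∷ 6 ∷ []
cube c₆  = 1 ∷ 3 ∷ 2 ∷ 5 ∷ 4 ∷ 6 ∷ []
cube c₇  = 1 ∷ 5 ∷ 2 ∷ 3 ∷ 4 ∷ 6 ∷ []
cube c₈  = 1 ∷ 5 ∷ 2 ∷ 4 ∷ 3 ∷ 6 ∷ []
cube c₉  = 1 ∷ 5 ∷ 2 ∷ 4 ∷ 6 ∷ 3 ∷ []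
cube c₁₀ = 1 ∷ 2 ∷ 3 ∷ 5 ∷ 6 ∷ 4 ∷ []
cube c₁₁ = 1 ∷ 3 ∷ 2 ∷ 5 ∷ 6 ∷ 4 ∷ []
cube c₁₂ = 1 ∷ 5 ∷ 2 ∷ 3 ∷ 6 ∷ 4 ∷ []
cube c₁₃ = 1 ∷ 5 ∷ 2 ∷ 6 ∷ 3 ∷ 4 ∷ []
cube c₁₄ = 1 ∷ 5 ∷ 2 ∷ 6 ∷ 4 ∷ 3 ∷ []
cube c₁₅ = 1 ∷ 2 ∷ 3 ∷ 4 ∷ 6 ∷ 5 ∷ []
cube c₁₆ = 1 ∷ 3 ∷ 2 ∷ 4 ∷ 6 ∷ 5 ∷ []
cube c₁₇ = 1 ∷ 4 ∷ 2 ∷ 3 ∷ 6 ∷ 5 ∷ []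
cube c₁₈ = 1 ∷ 4 ∷ 2 ∷ 6 ∷ 3 ∷ 5 ∷ []
cube c₁₉ = 1 ∷ 4 ∷ 2 ∷ 6 ∷ 5 ∷ 3 ∷ []
cube c₂₀ = 1 ∷ 2 ∷ 3 ∷ 6 ∷ 4 ∷ 5 ∷ []
cube c₂₁ = 1 ∷ 3 ∷ 2 ∷ 6 ∷ 4 ∷ 5 ∷ []
cube c₂₂ = 1 ∷ 6 ∷ 2 ∷ 3 ∷ 4 ∷ 5 ∷ []
cube c₂₃ = 1 ∷ 6 ∷ 2 ∷ 4 ∷ 3 ∷ 5 ∷ []
cube c₂₄ = 1 ∷ 6 ∷ 2 ∷ 4 ∷ 5 ∷ 3 ∷ []
cube c₂₅ = 1 ∷ 2 ∷ 3 ∷ 6 ∷ 5 ∷ 4 ∷ []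
cube c₂₆ = 1 ∷ 3 ∷ 2 ∷ 6 ∷ 5 ∷ 4 ∷ []
cube c₂₇ = 1 ∷ 6 ∷ 2 ∷ 3 ∷ 5 ∷ 4 ∷ []
cube c₂₈ = 1 ∷ 6 ∷ 2 ∷ 5 ∷ 3 ∷ 4 ∷ []
cube c₂₉ = 1 ∷ 6 ∷ 2 ∷ 5 ∷ 4 ∷ 3 ∷ []

position : Cube → Fin 30
position c₀  = # 0
position c₁  = # 1
position c₂  = # 2
position c₃  = # 3
position c₄  = # 4
position c₅  = # 5
position c₆  = # 6
position c₇  = # 7
position c₈  = # 8
position c₉  = # 9
position c₁₀ = # 10
position c₁₁ = # 11
position c₁₂ = # 12
position c₁₃ = # 13
position c₁₄ = # 14
position c₁₅ = # 15
position c₁₆ = # 16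
position c₁₇ = # 17
position c₁₈ = # 18
position c₁₉ = # 19
position c₂₀ = # 20
position c₂₁ = # 21
position c₂₂ = # 22
position c₂₃ = # 23
position c₂₄ = # 24
position c₂₅ = # 25
position c₂₆ = # 26
position c₂₇ = # 27
position c₂₈ = # 28
position c₂₉ = # 29

cubeAt : Fin 30 → Cube
cubeAt = Vec.lookup
  ( c₀ ∷ c₁ ∷ c₂ ∷ c₃ ∷ c₄ ∷ c₅ ∷ c₆ ∷ c₇ ∷ c₈ ∷ c₉ ∷ c₁₀ ∷ c₁₁ ∷ c₁₂ ∷ c₁₃ ∷ c₁₄
  ∷ c₁₅ ∷ c₁₆ ∷ c₁₇ ∷ c₁₈ ∷ c₁₉ ∷ c₂₀ ∷ c₂₁ ∷ c₂₂ ∷ c₂₃ ∷ c₂₄ ∷ c₂₅ ∷ c₂₆ ∷ c₂₇ ∷ c₂₈ ∷ c₂₉ ∷ [])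

cubeAt-position : ∀ c → cubeAt (position c) ≡ c
cubeAt-position c₀  = refl
cubeAt-position c₁  = refl
cubeAt-position c₂  = refl
cubeAt-position c₃  = refl
cubeAt-position c₄  = refl
cubeAt-position c₅  = refl
cubeAt-position c₆  = refl
cubeAt-position c₇  = refl
cubeAt-position c₈  = refl
cubeAt-position c₉  = refl
cubeAt-position c₁₀ = refl
cubeAt-position c₁₁ = refl
cubeAt-position c₁₂ = refl
cubeAt-position c₁₃ = refl
cubeAt-position c₁₄ = refl
cubeAt-position c₁₅ = refl
cubeAt-position c₁₆ = refl
cubeAt-position c₁₇ = refl
cubeAt-position c₁₈ = refl
cubeAt-position c₁₉ = refl
cubeAt-position c₂₀ = refl
cubeAt-position c₂₁ = refl
cubeAt-position c₂₂ = refl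
cubeAt-position c₂₃ = refl
cubeAt-position c₂₄ = refl
cubeAt-position c₂₅ = refl
cubeAt-position c₂₆ = refl
cubeAt-position c₂₇ = refl
cubeAt-position c₂₈ = refl
cubeAt-position c₂₉ = refl

cubes : List Cube
cubes = map cubeAt (allFin 30)

∈-cubes : ∀ c → c ∈ cubes
∈-cubes c = subst (_∈ cubes) (cubeAt-position c) (∈-map⁺ cubeAt (∈-allFin (position c)))

_≟_ : DecidableEquality Cube
i ≟ j = map′ position-injective (cong position) (position i Fin.≟ position j)
  where
  position-injective : position i ≡ position j → i ≡ j
  position-injective eq = trans (sym (cubeAt-position i)) (trans (cong cubeAt eq) (cubeAt-position j))

Unique-cubes : Unique cubes
Unique-cubes = Unique.map⁻ {f = position} (subst Unique (sym positions) (Unique.allFin⁺ 30))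
  where
  positions : map position cubes ≡ allFin 30
  positions = refl

allMacMahon≡ : allMacMahon ≡ map cube cubes
allMacMahon≡ = refl

eqListᵇ⇒≡ : ∀ xs ys → T (eqListᵇ xs ys) → xs ≡ ys
eqListᵇ⇒≡ []       []       _  = refl
eqListᵇ⇒≡ []       (_ ∷ _)  ()
eqListᵇ⇒≡ (_ ∷ _)  []       ()
eqListᵇ⇒≡ (x ∷ xs) (y ∷ ys) eq =
  let x≡y , xs≡ys = to T-∧ eq in cong₂ _∷_ (≡ᵇ⇒≡ x y x≡y) (eqListᵇ⇒≡ xs ys xs≡ys)

memListᵇ⇒∈ : ∀ xs xss → T (memListᵇ xs xss) → xs ∈ xss
memListᵇ⇒∈ xs (ys ∷ xss) h with to T-∨ h
... | inj₁ xs≡ys = here (eqListᵇ⇒≡ xs ys xs≡ys)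
... | inj₂ xs∈   = there (memListᵇ⇒∈ xs xss xs∈)

elemᵇ⇒∈ : ∀ n ns → T (elemᵇ n ns) → n ∈ ns
elemᵇ⇒∈ n (m ∷ ms) h with to T-∨ h
... | inj₁ n≡m = here (≡ᵇ⇒≡ n m n≡m)
... | inj₂ n∈  = there (elemᵇ⇒∈ n ms n∈)

MacMahon⇒∈ : ∀ {C} → MacMahon C → C ∈ map cube cubes
MacMahon⇒∈ {C} macMahon = subst (C ∈_) macMahonCubes
  (∈-filter⁺ (T? ∘ isMacMahon) (memListᵇ⇒∈ C allColorings (proj₁ (to T-∧ macMahon))) macMahon)
  where
  macMahonCubes : filterᵇ isMacMahon allColorings ≡ map cube cubes
  macMahonCubes = refl

cubeIndices : ∀ {W} → All MacMahon W → ∃ λ K → W ≡ map cube K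
cubeIndices []                             = [] , refl
cubeIndices {C ∷ W} (macMahon ∷ macMahons) =
  let k , _ , C≡ = ∈-map⁻ cube {xs = cubes} (MacMahon⇒∈ {C} macMahon)
      K , W≡     = cubeIndices macMahons
  in k ∷ K , cong₂ _∷_ C≡ W≡

-- disjoint i j, for i listed before j, records that the two cubes have no corner number in
-- common.  cornerTable checks every entry.
disjoint : Cube → Cube → Bool
disjoint c₀  = λ { c₄ → true ; c₆ → true ; c₇ → true ; c₉ → true ; c₁₅ → true ; c₁₈ → true ; c₂₃ → true ; c₂₆ → true ; c₂₇ → true ; _ → false }
disjoint c₁  = λ { c₄ → true ; c₅ → true ; c₁₂ → true ; c₁₃ → true ; c₁₆ → true ; c₁₈ → true ; c₂₂ → true ; c₂₅ → true ; c₂₉ → true ; _ → false }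
disjoint c₂  = λ { c₅ → true ; c₉ → true ; c₁₁ → true ; c₁₄ → true ; c₁₇ → true ; c₂₁ → true ; c₂₃ → true ; c₂₅ → true ; c₂₈ → true ; _ → false }
disjoint c₃  = λ { c₄ → true ; c₁₀ → true ; c₁₂ → true ; c₁₄ → true ; c₁₅ → true ; c₁₆ → true ; c₂₁ → true ; c₂₄ → true ; c₂₇ → true ; _ → false }
disjoint c₄  = λ { c₅ → true ; c₇ → true ; c₁₃ → true ; c₂₂ → true ; c₂₃ → true ; c₂₆ → true ; _ → false }
disjoint c₅  = λ { c₉ → true ; c₁₀ → true ; c₁₃ → true ; c₂₁ → true ; c₂₂ → true ; c₂₈ → true ; _ → false }
disjoint c₆  = λ { c₉ → true ; c₁₁ → true ; c₁₃ → true ; c₁₇ → true ; c₁₈ → true ; c₂₀ → true ; c₂₄ → true ; c₂₇ → true ; _ → false }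
disjoint c₇  = λ { c₁₂ → true ; c₁₆ → true ; c₁₉ → true ; c₂₀ → true ; c₂₃ → true ; c₂₆ → true ; c₂₈ → true ; _ → false }
disjoint c₈  = λ { c₉ → true ; c₁₀ → true ; c₁₁ → true ; c₁₅ → true ; c₁₇ → true ; c₁₉ → true ; c₂₂ → true ; c₂₆ → true ; c₂₉ → true ; _ → false }
disjoint c₉  = λ { c₁₈ → true ; c₂₁ → true ; c₂₇ → true ; c₂₈ → true ; _ → false }
disjoint c₁₀ = λ { c₁₄ → true ; c₁₆ → true ; c₁₇ → true ; c₂₆ → true ; c₂₇ → true ; c₂₉ → true ; _ → false }
disjoint c₁₁ = λ { c₁₄ → true ; c₁₅ → true ; c₁₉ → true ; c₂₂ → true ; c₂₃ → true ; c₂₅ → true ; _ → false }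
disjoint c₁₂ = λ { c₁₅ → true ; c₁₈ → true ; c₂₁ → true ; c₂₄ → true ; c₂₅ → true ; c₂₉ → true ; _ → false }
disjoint c₁₃ = λ { c₁₄ → true ; c₁₇ → true ; c₂₀ → true ; c₂₂ → true ; c₂₄ → true ; _ → false }
disjoint c₁₄ = λ { c₁₆ → true ; c₂₃ → true ; c₂₅ → true ; c₂₇ → true ; _ → false }
disjoint c₁₅ = λ { c₁₉ → true ; c₂₁ → true ; c₂₂ → true ; c₂₄ → true ; _ → false }
disjoint c₁₆ = λ { c₁₉ → true ; c₂₀ → true ; c₂₇ → true ; c₂₈ → true ; _ → false }
disjoint c₁₇ = λ { c₂₀ → true ; c₂₄ → true ; c₂₆ → true ; c₂₉ → true ; _ → false }
disjoint c₁₈ = λ { c₁₉ → true ; c₂₅ → true ; c₂₇ → true ; c₂₉ → true ; _ → false }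
disjoint c₁₉ = λ { c₂₀ → true ; c₂₂ → true ; c₂₈ → true ; _ → false }
disjoint c₂₀ = λ { c₂₄ → true ; c₂₅ → true ; c₂₈ → true ; _ → false }
disjoint c₂₁ = λ { c₂₄ → true ; c₂₆ → true ; c₂₈ → true ; _ → false }
disjoint c₂₂ = λ { c₂₇ → true ; _ → false }
disjoint c₂₃ = λ { c₂₄ → true ; c₂₅ → true ; c₂₆ → true ; _ → false }
disjoint c₂₄ = λ _ → false
disjoint c₂₅ = λ { c₂₉ → true ; _ → false }
disjoint c₂₆ = λ { c₂₉ → true ; _ → false }
disjoint c₂₇ = λ _ → false
disjoint c₂₈ = λ { c₂₉ → true ; _ → false }
disjoint c₂₉ = λ _ → false

_~_ : Cube → Cube → Bool
i ~ j = not (disjoint i j ∨ disjoint j i)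

~-sym : ∀ i j → i ~ j ≡ j ~ i
~-sym i j = cong not (∨-comm (disjoint i j) (disjoint j i))

cornerTable : All (λ i → All (λ j →
  T (i ~ j) ⊎ Disjoint (cornerNumbers (cube i)) (cornerNumbers (cube j))) cubes) cubes
cornerTable = from-yes (all? (λ i → all? (λ j →
  T? (i ~ j) ⊎-dec disjoint? (cornerNumbers (cube i)) (cornerNumbers (cube j))) cubes) cubes)

¬Disjoint⇒~ : ∀ i j → ¬ Disjoint (cornerNumbers (cube i)) (cornerNumbers (cube j)) → T (i ~ j)
¬Disjoint⇒~ i j shared =
  [ id , ⊥-elim ∘ shared ]′ (All.lookup (All.lookup cornerTable (∈-cubes i)) (∈-cubes j))

commonNeighbours : List Cube → List Cube
commonNeighbours = sieve _~_ cubes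

Unique-commonNeighbours : ∀ S → Unique (commonNeighbours S)
Unique-commonNeighbours S = Unique-sieve _~_ S Unique-cubes

length-commonNeighbours-++ : ∀ S S′ → length (commonNeighbours (S ++ S′)) ≤ length (commonNeighbours S)
length-commonNeighbours-++ S S′ = length-mono-≤ (sieve-++-⊆ _~_ cubes S S′)

compatible⇒corner : ∀ W p {C} → T (compatibleᵇ W p) → C ∈ W → ∃ λ n → n ∈ p × n ∈ cornerNumbers C
compatible⇒corner (C ∷ W) (n ∷ p) ok (here refl) = n , here refl , elemᵇ⇒∈ n _ (proj₁ (to T-∧ ok))
compatible⇒corner (C ∷ W) (n ∷ p) ok (there C∈) =
  let m , m∈ , m∈C = compatible⇒corner W p (proj₂ (to T-∧ ok)) C∈ in m , there m∈ , m∈C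

arrangement⇒¬Disjoint : ∀ {W xs C} → 0 < count (compatibleᵇ W) (permutations xs) → C ∈ W →
                         ¬ Disjoint (cornerNumbers C) xs
arrangement⇒¬Disjoint {W} {xs} pos C∈ disjoint with count>0⇒∈ (compatibleᵇ W) (permutations xs) pos
... | p , p∈ , ok with compatible⇒corner W p ok C∈
...   | n , n∈p , n∈C = disjoint (n∈C , ∈-resp-↭ (permutations-↭ xs p∈) n∈p)

canBuild⇒solution : ∀ W X → T (canBuildᵇ W X) → 0 < solutionNumber W X
canBuild⇒solution W X = <ᵇ⇒< 0 (solutionNumber W X)

solution⇒~ : ∀ K t → 0 < solutionNumber (map cube K) (cube t) → All (λ k → T (k ~ t)) K
solution⇒~ K t pos = All.tabulate (λ {k} k∈ →
  ¬Disjoint⇒~ k t (arrangement⇒¬Disjoint {map cube K} {cornerNumbers (cube t)} pos (∈-map⁺ cube k∈)))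

arrangeable : List Coloring → List ℕ → Bool
arrangeable []      xs = null xs
arrangeable (C ∷ W) xs = any (λ (x , rest) → elemᵇ x (cornerNumbers C) ∧ arrangeable W rest) (picks xs)

arrangeable-sound : ∀ W xs → T (arrangeable W xs) → ∃ λ p → p ∈ permutations xs × T (compatibleᵇ W p)
arrangeable-sound []      []      _  = [] , here refl , _
arrangeable-sound (C ∷ W) xs      ok with find (any⁻ _ (picks xs) ok)
... | (x , rest) , pick∈ , ok′ with to T-∧ ok′
...   | x∈C , okW with arrangeable-sound W rest okW
...     | p , p∈ , compatible = x ∷ p , picks-∈-permutations xs pick∈ p∈ , from T-∧ (x∈C , compatible)

arrangeable⇒arrangement : ∀ W xs → T (arrangeable W xs) → 0 < count (compatibleᵇ W) (permutations xs)
arrangeable⇒arrangement W xs ok =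
  let p , p∈ , compatible = arrangeable-sound W xs ok in ∈⇒count>0 (compatibleᵇ W) p∈ compatible

arrangeable⇒canBuild : ∀ W X → T (arrangeable W (cornerNumbers X)) → T (canBuildᵇ W X)
arrangeable⇒canBuild W X ok =
  <⇒<ᵇ {0} {solutionNumber W X} (arrangeable⇒arrangement W (cornerNumbers X) ok)

-- As _∨_ is lazy, the exhaustive canBuildᵇ is evaluated only where the backtracking search fails.
targetCountFast : List Cube → ℕ
targetCountFast K =
  count (λ t → arrangeable (map cube K) (cornerNumbers (cube t)) ∨ canBuildᵇ (map cube K) (cube t))
        (commonNeighbours K)

∨-redundant : ∀ {a b} → (T a → T b) → a ∨ b ≡ b
∨-redundant {true}  a⇒b = sym (to T-≡ (a⇒b _))
∨-redundant {false} _   = refl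

count-cubes : ∀ f → count f allMacMahon ≡ count (λ t → f (cube t)) cubes
count-cubes f = trans (cong (count f) allMacMahon≡) (count-map f cube cubes)

targetCount-cubes : ∀ W → targetCount W ≡ count (λ t → canBuildᵇ W (cube t)) cubes
targetCount-cubes W = count-cubes (canBuildᵇ W)

count-targets-commonNeighbours : ∀ K →
  count (λ t → canBuildᵇ (map cube K) (cube t)) (commonNeighbours K)
    ≡ count (λ t → canBuildᵇ (map cube K) (cube t)) cubes
count-targets-commonNeighbours K = count-sieve _~_ (λ t → canBuildᵇ (map cube K) (cube t)) cubes K
  (λ {t} _ built → solution⇒~ K t (canBuild⇒solution (map cube K) (cube t) built))

count-targets≡fast : ∀ K →
  count (λ t → canBuildᵇ (map cube K) (cube t)) (commonNeighbours K) ≡ targetCountFast K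
count-targets≡fast K = count-cong (commonNeighbours K) (λ {t} _ →
  sym (∨-redundant (arrangeable⇒canBuild (map cube K) (cube t))))

targetCount≡fast : ∀ K → targetCount (map cube K) ≡ targetCountFast K
targetCount≡fast K = begin
  targetCount (map cube K)
    ≡⟨ targetCount-cubes (map cube K) ⟩
  count (λ t → canBuildᵇ (map cube K) (cube t)) cubes
    ≡⟨ count-targets-commonNeighbours K ⟨
  count (λ t → canBuildᵇ (map cube K) (cube t)) (commonNeighbours K)
    ≡⟨ count-targets≡fast K ⟩
  targetCountFast K ∎
  where open ≡-Reasoning

targetCountFast≤commonNeighbours : ∀ K → targetCountFast K ≤ length (commonNeighbours K)
targetCountFast≤commonNeighbours K = count≤length
  (λ t → arrangeable (map cube K) (cornerNumbers (cube t)) ∨ canBuildᵇ (map cube K) (cube t))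
  (commonNeighbours K)

targetCount≤commonNeighbours : ∀ K → targetCount (map cube K) ≤ length (commonNeighbours K)
targetCount≤commonNeighbours K = begin
  targetCount (map cube K)    ≡⟨ targetCount≡fast K ⟩
  targetCountFast K           ≤⟨ targetCountFast≤commonNeighbours K ⟩
  length (commonNeighbours K) ∎
  where open ≤-Reasoning

-- Five common targets determine the collection

Rigid : List Cube → Set
Rigid N = length N < 8
        ⊎ (length N ≡ 8 × length (commonNeighbours N) ≤ 5 × All (_∉ commonNeighbours N) N)

rigid? : ∀ N → Dec (Rigid N)
rigid? N = length N <? 8
     ⊎-dec (length N ℕ.≟ 8 ×-dec length (commonNeighbours N) ≤? 5
              ×-dec all? (λ u → ¬? (DecMembership._∈?_ _≟_ u (commonNeighbours N))) N)

commonNeighbours-∷ʳ : ∀ S x → commonNeighbours (S ∷ʳ x) ≡ filterᵇ (x ~_) (commonNeighbours S)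
commonNeighbours-∷ʳ = sieve-∷ʳ _~_ cubes

nonRigid : List Cube → Bool
nonRigid S = isNo (rigid? (commonNeighbours S))

nonRigid-pruned : ∀ S S′ → T (length (commonNeighbours S) <ᵇ 8) → ¬ T (nonRigid (S ++ S′))
nonRigid-pruned S S′ few nonRigid =
  toWitnessFalse nonRigid (inj₁ (≤-<-trans (length-commonNeighbours-++ S S′) (<ᵇ⇒< _ 8 few)))

module RigidCount = PrunedCount commonNeighbours (λ N x → filterᵇ (x ~_) N) commonNeighbours-∷ʳ
  nonRigid (λ N → length N <ᵇ 8) nonRigid-pruned

nonRigid-count : count nonRigid (choose 5 cubes) ≡ 0
nonRigid-count = trans (sym (RigidCount.prunedCount-correct 5 cubes)) refl

rigidity : ∀ {S} → S ∈ choose 5 cubes → Rigid (commonNeighbours S)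
rigidity {S} S∈ = decidable-stable (rigid? (commonNeighbours S)) λ notRigid →
  n≮0 (subst (0 <_) nonRigid-count (∈⇒count>0 nonRigid S∈ (fromWitnessFalse notRigid)))

module _ {K : List Cube} (K-unique : Unique K) (|K|≡8 : length K ≡ 8)
         (five : 5 ≤ length (commonNeighbours K)) where

  private
    S : List Cube
    S = take 5 (commonNeighbours K)

    S⊆NK : S Sublist.⊆ commonNeighbours K
    S⊆NK = take-⊆ 5 (commonNeighbours K)

    S∈ : S ∈ choose 5 cubes
    S∈ = subst (λ k → S ∈ choose k cubes) (trans (length-take 5 (commonNeighbours K)) (m≤n⇒m⊓n≡m five))
               (∈-choose⁺ (Sublist.⊆-trans S⊆NK (sieve-⊆ _~_ cubes K)))

    K⊆NS : K ⊆ commonNeighbours S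
    K⊆NS {k} k∈ = ∈-sieve⁺ _~_ cubes S (∈-cubes k) (All.tabulate λ {s} s∈ →
      subst T (~-sym k s) (All.lookup (proj₂ (∈-sieve⁻ _~_ cubes K (Sublist.lookup S⊆NK s∈))) k∈))

    octet : length (commonNeighbours S) ≡ 8 × length (commonNeighbours (commonNeighbours S)) ≤ 5
          × All (_∉ commonNeighbours (commonNeighbours S)) (commonNeighbours S)
    octet = [ (λ <8 → ⊥-elim (<⇒≱ <8 8≤NS)) , id ]′ (rigidity S∈)
      where
      8≤NS : 8 ≤ length (commonNeighbours S)
      8≤NS = subst (_≤ length (commonNeighbours S)) |K|≡8
               (Unique-⊆⇒length≤ K-unique (Unique-commonNeighbours S) K⊆NS)

    NS⊆K : commonNeighbours S ⊆ K
    NS⊆K = Unique-⊆-length≥⇒⊇ _≟_ K-unique (Unique-commonNeighbours S) K⊆NS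
             (≤-reflexive (trans (proj₁ octet) (sym |K|≡8)))

    NK⊆NNS : commonNeighbours K ⊆ commonNeighbours (commonNeighbours S)
    NK⊆NNS {t} t∈ = let t∈cubes , K~t = ∈-sieve⁻ _~_ cubes K t∈ in
      ∈-sieve⁺ _~_ cubes (commonNeighbours S) t∈cubes (All.tabulate (All.lookup K~t ∘ NS⊆K))

  ≥5⇒length-commonNeighbours≤5 : length (commonNeighbours K) ≤ 5
  ≥5⇒length-commonNeighbours≤5 = ≤-trans
    (Unique-⊆⇒length≤ (Unique-commonNeighbours K) (Unique-commonNeighbours (commonNeighbours S)) NK⊆NNS)
    (proj₁ (proj₂ octet))

  ≥5⇒∉-commonNeighbours : ∀ {k} → k ∈ K → k ∉ commonNeighbours K
  ≥5⇒∉-commonNeighbours k∈ k∈NK = All.lookup (proj₂ (proj₂ octet)) (K⊆NS k∈) (NK⊆NNS k∈NK)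

length-commonNeighbours≤5 : ∀ {K} → Unique K → length K ≡ 8 → length (commonNeighbours K) ≤ 5
length-commonNeighbours≤5 {K} K-unique |K|≡8 with 5 ≤? length (commonNeighbours K)
... | yes five = ≥5⇒length-commonNeighbours≤5 K-unique |K|≡8 five
... | no  few  = <⇒≤ (≰⇒> few)

maximal⇒target∉ : ∀ {K k} → Unique K → length K ≡ 8 → targetCount (map cube K) ≡ 5 →
            0 < solutionNumber (map cube K) (cube k) → k ∉ K
maximal⇒target∉ {K} {k} K-unique |K|≡8 maximal built k∈K =
  ≥5⇒∉-commonNeighbours K-unique |K|≡8 five k∈K (∈-sieve⁺ _~_ cubes K (∈-cubes k) (solution⇒~ K k built))
  where
  five : 5 ≤ length (commonNeighbours K)
  five = subst (_≤ length (commonNeighbours K)) maximal (targetCount≤commonNeighbours K)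

collectionIndices : ∀ {W} → Collection W → ∃ λ K → W ≡ map cube K × Unique K × length K ≡ 8
collectionIndices (macMahon , unique , |W|≡8) =
  let K , W≡ = cubeIndices macMahon in
  K , W≡ , Unique.map⁻ (subst Unique W≡ unique)
    , trans (sym (length-map cube K)) (trans (cong length (sym W≡)) |W|≡8)

targetCount≤5 : (W : List Coloring) → Collection W → targetCount W ≤ 5
targetCount≤5 W collection =
  let K , W≡ , K-unique , |K|≡8 = collectionIndices collection in
  subst (λ V → targetCount V ≤ 5) (sym W≡)
    (≤-trans (targetCount≤commonNeighbours K) (length-commonNeighbours≤5 K-unique |K|≡8))

maximal⇒targets∉ : (W : List Coloring) → Collection W → targetCount W ≡ 5 →
           (X : Coloring) → MacMahon X → 0 < solutionNumber W X → X ∉ W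
maximal⇒targets∉ W collection maximal X _ built X∈W =
  -- MacMahon X is implied by X ∈ W.
  let K , W≡ , K-unique , |K|≡8 = collectionIndices collection
      k , k∈K , X≡ = ∈-map⁻ cube (subst (X ∈_) W≡ X∈W)
  in maximal⇒target∉ {K} {k} K-unique |K|≡8 (subst (λ V → targetCount V ≡ 5) W≡ maximal)
       (subst₂ (λ V Y → 0 < solutionNumber V Y) W≡ X≡ built) k∈K

maximal-pruned : ∀ K K′ → T (length (commonNeighbours K) <ᵇ 5) → ¬ T (targetCountFast (K ++ K′) ≡ᵇ 5)
maximal-pruned K K′ few maximal = <⇒≢ bound (≡ᵇ⇒≡ (targetCountFast (K ++ K′)) 5 maximal)
  where
  bound : targetCountFast (K ++ K′) < 5
  bound = begin-strict
    targetCountFast (K ++ K′)              ≤⟨ targetCountFast≤commonNeighbours (K ++ K′) ⟩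
    length (commonNeighbours (K ++ K′))    ≤⟨ length-commonNeighbours-++ K K′ ⟩
    length (commonNeighbours K)            <⟨ <ᵇ⇒< (length (commonNeighbours K)) 5 few ⟩
    5                                      ∎
    where open ≤-Reasoning

module MaximalCount = PrunedCount commonNeighbours (λ N x → filterᵇ (x ~_) N) commonNeighbours-∷ʳ
  (λ K → targetCountFast K ≡ᵇ 5) (λ N → length N <ᵇ 5) maximal-pruned

maximalCubeSets-count : count (λ K → targetCountFast K ≡ᵇ 5) (choose 8 cubes) ≡ 360
maximalCubeSets-count = trans (sym (MaximalCount.prunedCount-correct 8 cubes)) refl

count-subsets : ∀ k (f : List Coloring → Bool) (g : List Cube → Bool) → (∀ K → f (map cube K) ≡ g K) →
                count f (choose k allMacMahon) ≡ count g (choose k cubes)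
count-subsets k f g f≡g = begin
  count f (choose k allMacMahon)                ≡⟨ cong (λ Cs → count f (choose k Cs)) allMacMahon≡ ⟩
  count f (choose k (map cube cubes))           ≡⟨ cong (count f) (choose-map cube k cubes) ⟩
  count f (map (map cube) (choose k cubes))     ≡⟨ count-map f (map cube) (choose k cubes) ⟩
  count (λ K → f (map cube K)) (choose k cubes) ≡⟨ count-cong (choose k cubes) (λ {K} _ → f≡g K) ⟩
  count g (choose k cubes)                      ∎
  where open ≡-Reasoning

maximalCollections-count : count (λ W → targetCount W ≡ᵇ 5) (choose 8 allMacMahon) ≡ 360
maximalCollections-count = trans
  (count-subsets 8 (λ W → targetCount W ≡ᵇ 5) (λ K → targetCountFast K ≡ᵇ 5)
                   (λ K → cong (_≡ᵇ 5) (targetCount≡fast K)))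
  maximalCubeSets-count

theorem2 : ((W : List Coloring) → Collection W → targetCount W ≤ 5)
  × (count (λ W → targetCount W ≡ᵇ 5) (choose 8 allMacMahon) ≡ 360)
  × ((W : List Coloring) → Collection W → targetCount W ≡ 5 →
      (T : Coloring) → MacMahon T → 0 < solutionNumber W T → T ∉ W)
theorem2 = targetCount≤5 , maximalCollections-count , maximal⇒targets∉
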